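{- Fix $d\ge 1$ and finite families $\mathcal{F}_1,\dots,\mathcal{F}_d$ of finite graphs, and let $\Pi_i$ be the class of graphs with no induced subgraph isomorphic to a member of $\mathcal{F}_i$. Let $G$ be a graph, $W_1, W_2, U \subseteq V(G)$, and $\ell$ an integer. Let $X$ and $Y$ be disjoint $W_1$–$W_2$ separators in $G$ such that $X$ covers $Y$ and $(X \cup Y)\cap U = \emptyset$. If $X$ is $(\ell,U)$-good, then $Y$ is $(\ell,U)$-good.
   Context: For disjoint $A, S\subseteq V(G)$, $R(A,S)$ is the set of vertices reachable from $A$ in $G - S$, and $R[A,S] = R(A,S)\cup S$. A $W_1$–$W_2$ separator is a set $S$ disjoint from $W_1\cup W_2$ with $R(W_1,S)\cap W_2=\emptyset$. A separator $S_1$ covers $S$ (with respect to $W_1$) if $R(W_1,S)\subsetneq R(W_1,S_1)$. A set $Z \subseteq V(H)$ is a $(\Pi_1,\dots,\Pi_d)$-modulator of $H$ if every connected component of $H - Z$ belongs to at least one $\Pi_i$. A $W_1$–$W_2$ separator $X$ is $(\ell,U)$-good if there is a set $K$ with $|K|\le \ell$ such that $K\cup X$ is a $(\Pi_1,\dots,\Pi_d)$-modulator of $G[R[W_1,X]]$ and $(K\cup X)\cap U=\emptyset$. -}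

module Defs where

open import Level using (0ℓ)
open import Data.Nat using (ℕ; suc)
open import Data.Fin using (Fin)
open import Data.Fin.Subset using (Subset; _∈_; _∉_; _∪_; ∣_∣)
open import Data.List using (List)
open import Data.List.Membership.Propositional using () renaming (_∈_ to _∈ₗ_)
open import Data.Product using (Σ; ∃; _×_; _,_)
open import Data.Sum using (_⊎_)
open import Data.Integer using (ℤ; +_) renaming (_≤_ to _≤ℤ_)
open import Relation.Nullary using (¬_)
open import Relation.Binary.PropositionalEquality using (_≡_)
open import Function.Definitions using (Injective)
open import Function.Bundles using (_⇔_)

record Graph : Set₁ where
  field
    n      : ℕ
    E      : Fin n → Fin n → Set
    sym    : ∀ {x y} → E x y → E y x
    irrefl : ∀ {x} → ¬ E x x

open Graph public

module _ (G : Graph) where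

  VSet : Set₁
  VSet = Fin (n G) → Set

  data Reach (A S : Subset (n G)) : Fin (n G) → Set where
    base : ∀ {v} → v ∈ A → v ∉ S → Reach A S v
    step : ∀ {u v} → Reach A S u → E G u v → v ∉ S → Reach A S v

  ReachC : Subset (n G) → Subset (n G) → VSet
  ReachC A S v = Reach A S v ⊎ v ∈ S

  Separator : (W₁ W₂ S : Subset (n G)) → Set
  Separator W₁ W₂ S =
    (∀ v → v ∈ S → v ∉ W₁ × v ∉ W₂) × (∀ v → Reach W₁ S v → v ∉ W₂)

  Covers : (W₁ S₁ S : Subset (n G)) → Set
  Covers W₁ S₁ S =
    (∀ v → Reach W₁ S v → Reach W₁ S₁ v) × ∃ (λ v → Reach W₁ S₁ v × ¬ Reach W₁ S v)

  data Walk (C : VSet) : Fin (n G) → Fin (n G) → Set where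
    here : ∀ {x} → C x → Walk C x x
    step : ∀ {x y z} → Walk C x y → E G y z → C z → Walk C x z

  IsComponent : (C D : VSet) → Set
  IsComponent C D =
    (∀ v → D v → C v) × ∃ D × (∀ x y → D x → D y → Walk D x y)
    × (∀ x y → D x → E G x y → C y → D y)

  HasInduced : VSet → Graph → Set
  HasInduced D F = Σ (Fin (n F) → Fin (n G)) λ f →
    Injective _≡_ _≡_ f × (∀ a → D (f a)) × (∀ a b → E F a b ⇔ E G (f a) (f b))

  InΠ : List Graph → VSet → Set₁
  InΠ 𝓕 D = ∀ F → F ∈ₗ 𝓕 → ¬ HasInduced D F

  Modulator : ∀ {d} → (Fin d → List Graph) → VSet → Subset (n G) → Set₁
  Modulator 𝓕s H Z =
    ∀ D → IsComponent (λ v → H v × v ∉ Z) D → ∃ λ i → InΠ (𝓕s i) D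

  Good : ∀ {d} → (Fin d → List Graph) → (W₁ X : Subset (n G)) → ℤ → Subset (n G) → Set₁
  Good 𝓕s W₁ X ℓ U = ∃ λ (K : Subset (n G)) →
    (+ ∣ K ∣ ≤ℤ ℓ) × Modulator 𝓕s (ReachC W₁ X) (K ∪ X)
    × (∀ v → v ∈ K ∪ X → v ∉ U)

module Submission where

-- Since R(W₁,Y) ⊆ R(W₁,X) and R(W₁,X) avoids X, the graph G[R[W₁,Y]] − (K ∪ Y)
-- is an induced subgraph of G[R[W₁,X]] − (K ∪ X).  Each component of the former
-- therefore lies inside a component of the latter, and the classes Πᵢ, being
-- defined by forbidden induced subgraphs, are closed under induced subgraphs.
-- So the same K witnesses goodness of Y.

open import Defs
open import Data.Nat using (ℕ; suc)
open import Data.Fin using (Fin)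
open import Data.Fin.Subset using (Subset; _∈_; _∉_; _∪_)
open import Data.Fin.Subset.Properties using (x∈p∪q⁻; x∈p∪q⁺)
open import Data.List using (List)
open import Data.Integer using (ℤ)
open import Data.Product using (∃; _×_; _,_)
open import Data.Sum using (inj₁; inj₂)
open import Data.Empty using (⊥-elim)
open import Relation.Unary using (_⊆_)

module _ (G : Graph) where

  Walk-source : ∀ {C : VSet G} {x y} → Walk G C x y → C x
  Walk-source (here c)     = c
  Walk-source (step w _ _) = Walk-source w

  Walk-prepend : ∀ {C : VSet G} {x y z} → E G x y → C x → Walk G C y z → Walk G C x z
  Walk-prepend e c (here c′)     = step (here c) e c′
  Walk-prepend e c (step w e′ c′) = step (Walk-prepend e c w) e′ c′

  Walk-reverse : ∀ {C : VSet G} {x y} → Walk G C x y → Walk G C y x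
  Walk-reverse (here c)     = here c
  Walk-reverse (step w e c) = Walk-prepend (sym G e) c (Walk-reverse w)

  Walk-++ : ∀ {C : VSet G} {x y z} → Walk G C x y → Walk G C y z → Walk G C x z
  Walk-++ w (here _)      = w
  Walk-++ w (step w′ e c) = step (Walk-++ w w′) e c

  Walk-map : ∀ {C C′ : VSet G} {x y} → C ⊆ C′ → Walk G C x y → Walk G C′ x y
  Walk-map C⊆C′ (here c)     = here (C⊆C′ c)
  Walk-map C⊆C′ (step w e c) = step (Walk-map C⊆C′ w) e (C⊆C′ c)

  Walk-within-reachable : ∀ {C : VSet G} {a x} → Walk G C a x → Walk G (Walk G C a) a x
  Walk-within-reachable (here c)     = here (here c)
  Walk-within-reachable (step w e c) = step (Walk-within-reachable w) e (step w e c)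

  reachable-isComponent : ∀ {C : VSet G} {a} → C a → IsComponent G C (Walk G C a)
  reachable-isComponent {a = a} Ca =
      (λ _ w → Walk-source (Walk-reverse w))
    , (a , here Ca)
    , (λ _ _ wx wy → Walk-++ (Walk-reverse (Walk-within-reachable wx)) (Walk-within-reachable wy))
    , (λ _ _ w e c → step w e c)

  isComponent-⊆-isComponent : ∀ {C C′ D : VSet G} → C ⊆ C′ → IsComponent G C D →
                              ∃ λ D′ → IsComponent G C′ D′ × D ⊆ D′
  isComponent-⊆-isComponent C⊆C′ (D⊆C , (a , Da) , connected , _) =
      Walk G _ a
    , reachable-isComponent (C⊆C′ (D⊆C a Da))
    , λ {x} Dx → Walk-map (λ {v} Dv → C⊆C′ (D⊆C v Dv)) (connected a x Da Dx)

  InΠ-antitone : ∀ {𝓕 : List Graph} {D D′ : VSet G} → D ⊆ D′ → InΠ G 𝓕 D′ → InΠ G 𝓕 D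
  InΠ-antitone D⊆D′ D′∈Π F F∈𝓕 (f , f-inj , f∈D , f-iso) =
    D′∈Π F F∈𝓕 (f , f-inj , (λ a → D⊆D′ (f∈D a)) , f-iso)

  Modulator-antitone : ∀ {d} {𝓕s : Fin d → List Graph} {H H′ : VSet G} {Z Z′ : Subset (n G)} →
                       (λ v → H v × v ∉ Z) ⊆ (λ v → H′ v × v ∉ Z′) →
                       Modulator G 𝓕s H′ Z′ → Modulator G 𝓕s H Z
  Modulator-antitone region⊆ modulator′ D D-component
    with isComponent-⊆-isComponent region⊆ D-component
  ... | D′ , D′-component , D⊆D′ with modulator′ D′ D′-component
  ...   | i , D′∈Πᵢ = i , InΠ-antitone {D = D} D⊆D′ D′∈Πᵢ

  Reach-avoids : ∀ {A S : Subset (n G)} {v} → Reach G A S v → v ∉ S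
  Reach-avoids (base _ v∉S)   = v∉S
  Reach-avoids (step _ _ v∉S) = v∉S

  covered-region-⊆ : ∀ {W₁ X Y K : Subset (n G)} → (∀ v → Reach G W₁ Y v → Reach G W₁ X v) →
                     (λ v → ReachC G W₁ Y v × v ∉ K ∪ Y) ⊆ (λ v → ReachC G W₁ X v × v ∉ K ∪ X)
  covered-region-⊆ RY⊆RX (inj₂ v∈Y , v∉K∪Y) = ⊥-elim (v∉K∪Y (x∈p∪q⁺ (inj₂ v∈Y)))
  covered-region-⊆ {X = X} {K = K} RY⊆RX {v} (inj₁ r , v∉K∪Y) =
    inj₁ (RY⊆RX v r) , v∉K∪X
    where
    v∉K∪X : v ∉ K ∪ X
    v∉K∪X v∈K∪X with x∈p∪q⁻ K X v∈K∪X
    ... | inj₁ v∈K = v∉K∪Y (x∈p∪q⁺ (inj₁ v∈K))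
    ... | inj₂ v∈X = Reach-avoids (RY⊆RX v r) v∈X

∪-avoids : ∀ {m} (P Q : Subset m) {U : Subset m} →
           (∀ v → v ∈ P → v ∉ U) → (∀ v → v ∈ Q → v ∉ U) → ∀ v → v ∈ P ∪ Q → v ∉ U
∪-avoids P Q P∩U=∅ Q∩U=∅ v v∈P∪Q with x∈p∪q⁻ P Q v∈P∪Q
... | inj₁ v∈P = P∩U=∅ v v∈P
... | inj₂ v∈Q = Q∩U=∅ v v∈Q

lemma8 : ∀ {d : ℕ} (𝓕s : Fin (suc d) → List Graph) (G : Graph)
           (W₁ W₂ U X Y : Subset (n G)) (ℓ : ℤ) →
           (∀ v → v ∈ X → v ∉ Y) →
           Separator G W₁ W₂ X → Separator G W₁ W₂ Y →
           Covers G W₁ X Y →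
           (∀ v → v ∈ X ∪ Y → v ∉ U) →
           Good G 𝓕s W₁ X ℓ U → Good G 𝓕s W₁ Y ℓ U
lemma8 𝓕s G W₁ W₂ U X Y ℓ _ _ _ (RY⊆RX , _) X∪Y∩U=∅ (K , |K|≤ℓ , X-modulator , K∪X∩U=∅) =
    K
  , |K|≤ℓ
  , Modulator-antitone G (covered-region-⊆ G RY⊆RX) X-modulator
  , ∪-avoids K Y K∩U=∅ Y∩U=∅
  where
  K∩U=∅ : ∀ v → v ∈ K → v ∉ U
  K∩U=∅ v v∈K = K∪X∩U=∅ v (x∈p∪q⁺ (inj₁ v∈K))
  Y∩U=∅ : ∀ v → v ∈ Y → v ∉ U
  Y∩U=∅ v v∈Y = X∪Y∩U=∅ v (x∈p∪q⁺ (inj₂ v∈Y))
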